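{- Every connected $P_5$-free chordal bipartite graph is bisplit.
   Context: Graphs are finite, simple and undirected. A bipartite graph is chordal bipartite if every cycle of length at least six has a chord. $P_5$-free means no induced path on five vertices. A graph $G$ is bisplit if its vertex set can be partitioned into three stable (independent) sets $X$, $Y$, $Z$ such that $Y\cup Z$ induces a complete bipartite subgraph of $G$. -}

module Defs where

open import Data.Nat using (ℕ; zero; suc; _≤_; _∸_)
open import Data.Fin using (Fin; toℕ)
open import Data.Bool using (Bool)
open import Data.Product using (Σ; ∃; _×_; _,_)
open import Data.Sum using (_⊎_)
open import Relation.Nullary using (¬_; Dec)
open import Relation.Binary.PropositionalEquality using (_≡_; _≢_)
open import Function.Definitions using (Injective)
open import Function.Bundles using (_⇔_)

record Graph (n : ℕ) : Set₁ where
  field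
    Adj     : Fin n → Fin n → Set
    sym     : ∀ {u v} → Adj u v → Adj v u
    irrefl  : ∀ {u} → ¬ Adj u u
    dec     : ∀ u v → Dec (Adj u v)
open Graph public

module _ {n : ℕ} (G : Graph n) where

  data Walk : Fin n → Fin n → Set where
    here : ∀ {u} → Walk u u
    step : ∀ {u v w} → Adj G u v → Walk v w → Walk u w

  Connected : Set
  Connected = ∀ u v → Walk u v

  Bipartite : Set
  Bipartite = Σ (Fin n → Bool) λ c → ∀ u v → Adj G u v → c u ≢ c v

  CycNext : (k : ℕ) → Fin k → Fin k → Set
  CycNext k i j = (toℕ j ≡ suc (toℕ i)) ⊎ ((toℕ i ≡ k ∸ 1) × (toℕ j ≡ 0))

  IsCycle : (k : ℕ) → (Fin k → Fin n) → Set
  IsCycle k c = Injective _≡_ _≡_ c × (∀ i j → CycNext k i j → Adj G (c i) (c j))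

  HasChord : (k : ℕ) → (Fin k → Fin n) → Set
  HasChord k c = ∃ λ i → ∃ λ j →
    Adj G (c i) (c j) × ¬ CycNext k i j × ¬ CycNext k j i

  ChordalBipartite : Set
  ChordalBipartite = Bipartite ×
    (∀ k (c : Fin k → Fin n) → 6 ≤ k → IsCycle k c → HasChord k c)

  InducedP5 : (Fin 5 → Fin n) → Set
  InducedP5 p = Injective _≡_ _≡_ p ×
    (∀ i j → Adj G (p i) (p j) ⇔ ((toℕ j ≡ suc (toℕ i)) ⊎ (toℕ i ≡ suc (toℕ j))))

  P5Free : Set
  P5Free = ¬ (∃ λ p → InducedP5 p)

  -- Bisplit: partition into X (0), Y (1), Z (2), each stable, with Y ∪ Z
  -- inducing a complete bipartite graph (biclique) with nonempty sides Y, Z.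
  Stable : (Fin n → Set) → Set
  Stable S = ∀ u v → S u → S v → ¬ Adj G u v

  Bisplit : Set
  Bisplit = Σ (Fin n → Fin 3) λ part →
    Stable (λ v → part v ≡ Fin.zero) ×
    Stable (λ v → part v ≡ Fin.suc Fin.zero) ×
    Stable (λ v → part v ≡ Fin.suc (Fin.suc Fin.zero)) ×
    (∃ λ y → part y ≡ Fin.suc Fin.zero) ×
    (∃ λ z → part z ≡ Fin.suc (Fin.suc Fin.zero)) ×
    (∀ y z → part y ≡ Fin.suc Fin.zero → part z ≡ Fin.suc (Fin.suc Fin.zero) → Adj G y z)

{-# OPTIONS --safe #-}
-- Fix an edge ab and 2-colour G.  Put Z = N(a), and let Y consist of the vertices
-- on a's side whose neighbourhood contains N(a); then Y ∪ Z is a biclique containing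
-- a and b.  An edge uv of the remaining vertices X with v adjacent to some t ∈ Y ∪ Z
-- extends, through a and a vertex of N(a) missed by u or v, to an induced P5.  So the
-- endpoints of X-edges have all their neighbours in X; by connectivity this would
-- reach a ∈ Y, hence X is stable.
module Submission where

open import Defs
open import Data.Nat using (ℕ; zero; suc; _≤_; s≤s)
import Data.Nat as ℕ
open import Data.Fin using (Fin; toℕ) renaming (zero to fz; suc to fs)
import Data.Fin as Fin
open import Data.Fin.Properties using (all?; ¬∀⟶∃¬)
open import Data.Bool using (Bool)
import Data.Bool as Bool
open import Data.Bool.Properties using (¬-not)
open import Data.Product using (∃; _×_; _,_)
open import Data.Sum using (_⊎_; inj₁; inj₂)
open import Data.Empty using (⊥-elim)
open import Data.Unit using (tt)
open import Relation.Nullary using (¬_; Dec; yes; no)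
open import Relation.Nullary.Decidable
  using (True; False; toWitness; toWitnessFalse; _×-dec_; _→-dec_; _⊎-dec_)
open import Relation.Unary using (Decidable)
open import Relation.Binary.PropositionalEquality
  using (_≡_; _≢_; refl; subst; trans) renaming (sym to ≡-sym)
open import Function.Definitions using (Injective)
open import Function.Bundles using (_⇔_; mk⇔; Equivalence)
open import Function.Base using (_∘′_)

pattern i0 = fz
pattern i1 = fs fz
pattern i2 = fs (fs fz)
pattern i3 = fs (fs (fs fz))
pattern i4 = fs (fs (fs (fs fz)))

≢-≢⇒≡ : ∀ {x y w : Bool} → x ≢ w → y ≢ w → x ≡ y
≢-≢⇒≡ x≢w y≢w = trans (¬-not x≢w) (≡-sym (¬-not y≢w))

PathAdj : Fin 5 → Fin 5 → Set
PathAdj i j = (toℕ j ≡ suc (toℕ i)) ⊎ (toℕ i ≡ suc (toℕ j))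

PathAdj? : ∀ i j → Dec (PathAdj i j)
PathAdj? i j = (toℕ j ℕ.≟ suc (toℕ i)) ⊎-dec (toℕ i ℕ.≟ suc (toℕ j))

PathAdj-rows-distinct : ∀ i j → (∀ l → (PathAdj i l → PathAdj j l) × (PathAdj j l → PathAdj i l)) → i ≡ j
PathAdj-rows-distinct = toWitness {a? = all? λ i → all? λ j →
  all? (λ l → (PathAdj? i l →-dec PathAdj? j l) ×-dec (PathAdj? j l →-dec PathAdj? i l))
    →-dec (i Fin.≟ j)} tt

module _ {n : ℕ} (G : Graph n) where

  walk-preserves : (S : Fin n → Set) → (∀ {x y} → Adj G x y → S x → S y) →
                   ∀ {u v} → Walk G u v → S u → S v
  walk-preserves S closed here      su = su
  walk-preserves S closed (step e w) su = walk-preserves S closed w (closed e su)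

  neighbourhood-⊈ : ∀ u v → ¬ (∀ z → Adj G u z → Adj G v z) → ∃ λ z → Adj G u z × ¬ Adj G v z
  neighbourhood-⊈ u v N⊈ with ¬∀⟶∃¬ n _ (λ z → dec G u z →-dec dec G v z) N⊈
  ... | z , ¬uz⇒vz with dec G u z
  ...   | yes uz = z , uz , λ vz → ¬uz⇒vz λ _ → vz
  ...   | no ¬uz = ⊥-elim (¬uz⇒vz λ uz → ⊥-elim (¬uz uz))

  adjacency-pattern-injective : (p : Fin 5 → Fin n) → (∀ i j → Adj G (p i) (p j) ⇔ PathAdj i j) →
                                Injective _≡_ _≡_ p
  adjacency-pattern-injective p adj⇔ {i} {j} pi≡pj = PathAdj-rows-distinct i j λ l →
      (λ r → to j l (subst (λ x → Adj G x (p l)) pi≡pj (from i l r)))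
    , (λ r → to i l (subst (λ x → Adj G x (p l)) (≡-sym pi≡pj) (from j l r)))
    where
    to : ∀ i j → Adj G (p i) (p j) → PathAdj i j
    to i j = Equivalence.to (adj⇔ i j)
    from : ∀ i j → PathAdj i j → Adj G (p i) (p j)
    from i j = Equivalence.from (adj⇔ i j)

  module _ (v0 v1 v2 v3 v4 : Fin n)
    (a01 : Adj G v0 v1) (a12 : Adj G v1 v2) (a23 : Adj G v2 v3) (a34 : Adj G v3 v4)
    (n02 : ¬ Adj G v0 v2) (n03 : ¬ Adj G v0 v3) (n04 : ¬ Adj G v0 v4)
    (n13 : ¬ Adj G v1 v3) (n14 : ¬ Adj G v1 v4) (n24 : ¬ Adj G v2 v4) where

    private
      p : Fin 5 → Fin n
      p i0 = v0
      p i1 = v1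
      p i2 = v2
      p i3 = v3
      p i4 = v4

      linked : ∀ i j → Adj G (p i) (p j) → {True (PathAdj? i j)} → Adj G (p i) (p j) ⇔ PathAdj i j
      linked i j e {r} = mk⇔ (λ _ → toWitness r) (λ _ → e)

      unlinked : ∀ i j → ¬ Adj G (p i) (p j) → {False (PathAdj? i j)} → Adj G (p i) (p j) ⇔ PathAdj i j
      unlinked i j ¬e {¬r} = mk⇔ (λ e → ⊥-elim (¬e e)) (λ r → ⊥-elim (toWitnessFalse ¬r r))

      adj⇔ : ∀ i j → Adj G (p i) (p j) ⇔ PathAdj i j
      adj⇔ i0 i0 = unlinked i0 i0 (irrefl G)
      adj⇔ i0 i1 = linked   i0 i1 a01
      adj⇔ i0 i2 = unlinked i0 i2 n02
      adj⇔ i0 i3 = unlinked i0 i3 n03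
      adj⇔ i0 i4 = unlinked i0 i4 n04
      adj⇔ i1 i0 = linked   i1 i0 (sym G a01)
      adj⇔ i1 i1 = unlinked i1 i1 (irrefl G)
      adj⇔ i1 i2 = linked   i1 i2 a12
      adj⇔ i1 i3 = unlinked i1 i3 n13
      adj⇔ i1 i4 = unlinked i1 i4 n14
      adj⇔ i2 i0 = unlinked i2 i0 (n02 ∘′ sym G)
      adj⇔ i2 i1 = linked   i2 i1 (sym G a12)
      adj⇔ i2 i2 = unlinked i2 i2 (irrefl G)
      adj⇔ i2 i3 = linked   i2 i3 a23
      adj⇔ i2 i4 = unlinked i2 i4 n24
      adj⇔ i3 i0 = unlinked i3 i0 (n03 ∘′ sym G)
      adj⇔ i3 i1 = unlinked i3 i1 (n13 ∘′ sym G)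
      adj⇔ i3 i2 = linked   i3 i2 (sym G a23)
      adj⇔ i3 i3 = unlinked i3 i3 (irrefl G)
      adj⇔ i3 i4 = linked   i3 i4 a34
      adj⇔ i4 i0 = unlinked i4 i0 (n04 ∘′ sym G)
      adj⇔ i4 i1 = unlinked i4 i1 (n14 ∘′ sym G)
      adj⇔ i4 i2 = unlinked i4 i2 (n24 ∘′ sym G)
      adj⇔ i4 i3 = linked   i4 i3 (sym G a34)
      adj⇔ i4 i4 = unlinked i4 i4 (irrefl G)

    induced-P5 : ∃ λ q → InducedP5 G q
    induced-P5 = p , adjacency-pattern-injective p adj⇔ , adj⇔

  module _ (Y Z : Fin n → Set) (Y? : Decidable Y) (Z? : Decidable Z) where

    private
      part : Fin n → Fin 3
      part v with Y? v | Z? v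
      ... | yes _ | _     = i1
      ... | no _  | yes _ = i2
      ... | no _  | no _  = i0

      part≡0 : ∀ {v} → part v ≡ i0 → ¬ Y v × ¬ Z v
      part≡0 {v} with Y? v | Z? v
      ... | yes _  | _      = λ ()
      ... | no _   | yes _  = λ ()
      ... | no ¬yv | no ¬zv = λ _ → ¬yv , ¬zv

      part≡1 : ∀ {v} → part v ≡ i1 → Y v
      part≡1 {v} with Y? v | Z? v
      ... | yes yv | _     = λ _ → yv
      ... | no _   | yes _ = λ ()
      ... | no _   | no _  = λ ()

      part≡2 : ∀ {v} → part v ≡ i2 → Z v
      part≡2 {v} with Y? v | Z? v
      ... | yes _ | _      = λ ()
      ... | no _  | yes zv = λ _ → zv
      ... | no _  | no _   = λ ()

      Y⇒part≡1 : ∀ {v} → Y v → part v ≡ i1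
      Y⇒part≡1 {v} yv with Y? v
      ... | yes _  = refl
      ... | no ¬yv = ⊥-elim (¬yv yv)

      Z⇒part≡2 : ∀ {v} → ¬ Y v → Z v → part v ≡ i2
      Z⇒part≡2 {v} ¬yv zv with Y? v | Z? v
      ... | yes yv | _      = ⊥-elim (¬yv yv)
      ... | no _   | yes _  = refl
      ... | no _   | no ¬zv = ⊥-elim (¬zv zv)

    bisplit-from : Stable G (λ v → ¬ Y v × ¬ Z v) → Stable G Y → Stable G Z →
                   (∀ y z → Y y → Z z → Adj G y z) →
                   ∀ y z → Y y → ¬ Y z → Z z → Bisplit G
    bisplit-from X-stable Y-stable Z-stable complete y z yy ¬yz zz = part
      , (λ u v pu pv → X-stable u v (part≡0 pu) (part≡0 pv))
      , (λ u v pu pv → Y-stable u v (part≡1 pu) (part≡1 pv))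
      , (λ u v pu pv → Z-stable u v (part≡2 pu) (part≡2 pv))
      , (y , Y⇒part≡1 yy)
      , (z , Z⇒part≡2 ¬yz zz)
      , (λ u v pu pv → complete u v (part≡1 pu) (part≡2 pv))

module DominatorPartition {n : ℕ} (G : Graph n) (P5-free : P5Free G)
  (c : Fin n → Bool) (proper : ∀ u v → Adj G u v → c u ≢ c v) (a : Fin n) where

  Dominates : Fin n → Set
  Dominates v = ∀ z → Adj G a z → Adj G v z

  Y Z X : Fin n → Set
  Y v = c v ≡ c a × Dominates v
  Z v = Adj G a v
  X v = ¬ Y v × ¬ Z v

  Y? : Decidable Y
  Y? v = (c v Bool.≟ c a) ×-dec all? (λ z → dec G a z →-dec dec G v z)

  same-colour⇒¬adj : ∀ {u v} → c u ≡ c v → ¬ Adj G u v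
  same-colour⇒¬adj {u} {v} cu≡cv uv = proper u v uv cu≡cv

  Z-opposite : ∀ {v} → Z v → c v ≢ c a
  Z-opposite {v} av cv≡ca = proper a v av (≡-sym cv≡ca)

  missed-neighbour : ∀ {v} → c v ≡ c a → ¬ Y v → ∃ λ z → Adj G a z × ¬ Adj G v z
  missed-neighbour {v} cv≡ca ¬yv = neighbourhood-⊈ G a v λ dom → ¬yv (cv≡ca , dom)

  -- If c v = c a then t ∈ Z and u v t a z is an induced P5, otherwise t ∈ Y and
  -- u v t z a is one; z is a neighbour of a missed by v, resp. u.
  X-edge-closed : ∀ {u v t} → X u → X v → Adj G u v → Adj G v t → ¬ (Y t ⊎ Z t)
  X-edge-closed {u} {v} {t} (¬yu , ¬zu) (¬yv , ¬zv) uv vt yzt with c v Bool.≟ c a | yzt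
  ... | yes cv≡ca | inj₁ (ct≡ca , _) = same-colour⇒¬adj (trans cv≡ca (≡-sym ct≡ca)) vt
  ... | yes cv≡ca | inj₂ at
    with z , az , ¬vz ← missed-neighbour cv≡ca ¬yv =
    let cu≢ca = λ cu≡ca → proper u v uv (trans cu≡ca (≡-sym cv≡ca))
    in P5-free (induced-P5 G u v t a z uv vt (sym G at) az
         (same-colour⇒¬adj (≢-≢⇒≡ cu≢ca (Z-opposite at))) (¬zu ∘′ sym G)
         (same-colour⇒¬adj (≢-≢⇒≡ cu≢ca (Z-opposite az))) (same-colour⇒¬adj cv≡ca) ¬vz
         (same-colour⇒¬adj (≢-≢⇒≡ (Z-opposite at) (Z-opposite az))))
  ... | no cv≢ca | inj₂ at = same-colour⇒¬adj (≢-≢⇒≡ cv≢ca (Z-opposite at)) vt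
  ... | no cv≢ca | inj₁ (ct≡ca , t-dom)
    with cu≡ca ← ≢-≢⇒≡ (proper u v uv) (cv≢ca ∘′ ≡-sym)
    with z , az , ¬uz ← missed-neighbour cu≡ca ¬yu =
    P5-free (induced-P5 G u v t z a uv vt (t-dom z az) (sym G az)
      (same-colour⇒¬adj (trans cu≡ca (≡-sym ct≡ca))) ¬uz (same-colour⇒¬adj cu≡ca)
      (same-colour⇒¬adj (≢-≢⇒≡ cv≢ca (Z-opposite az))) (¬zv ∘′ sym G)
      (same-colour⇒¬adj ct≡ca))

  a∈Y : Y a
  a∈Y = refl , λ _ az → az

  X-stable : Connected G → Stable G X
  X-stable connected u v xu xv uv =
    let _ , _ , (¬ya , _) , _ = walk-preserves G InXEdge step-closed (connected v a) (u , xu , xv , uv)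
    in ¬ya a∈Y
    where
    InXEdge : Fin n → Set
    InXEdge w = ∃ λ u → X u × X w × Adj G u w

    step-closed : ∀ {w w′} → Adj G w w′ → InXEdge w → InXEdge w′
    step-closed ww′ (_ , xu , xw , uw) =
      _ , xw , (X-edge-closed xu xw uw ww′ ∘′ inj₁ , X-edge-closed xu xw uw ww′ ∘′ inj₂) , ww′

  Y-stable : Stable G Y
  Y-stable u v (cu≡ca , _) (cv≡ca , _) = same-colour⇒¬adj (trans cu≡ca (≡-sym cv≡ca))

  Z-stable : Stable G Z
  Z-stable u v au av = same-colour⇒¬adj (≢-≢⇒≡ (Z-opposite au) (Z-opposite av))

  Y-Z-complete : ∀ y z → Y y → Z z → Adj G y z
  Y-Z-complete y z (_ , y-dom) az = y-dom z az

  Z⇒¬Y : ∀ {v} → Z v → ¬ Y v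
  Z⇒¬Y av (cv≡ca , _) = Z-opposite av cv≡ca

  bisplit : Connected G → ∀ {b} → Adj G a b → Bisplit G
  bisplit connected {b} ab = bisplit-from G Y Z Y? (dec G a)
    (X-stable connected) Y-stable Z-stable Y-Z-complete a b a∈Y (Z⇒¬Y ab) ab

lemma4 : ∀ (n : ℕ) (G : Graph n) → 2 ≤ n → Connected G → P5Free G →
    ChordalBipartite G → Bisplit G
lemma4 (suc zero) G (s≤s ()) _ _ _
lemma4 (suc (suc _)) G _ connected P5-free ((c , proper) , _) with connected i0 i1
... | step ab _ = DominatorPartition.bisplit G P5-free c proper i0 connected ab
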